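{- Let $r\ge3$ and let $\vec G$ be a $C^\circlearrowright_r$-free orientation of a graph $G$ on $n$ vertices. There exists a set $S\subset E(\vec G)$ with $|S|\le 2n\cdot(r-2)\alpha(G)$ such that $\vec G$ is the unique $C^\circlearrowright_r$-free orientation of $G$ containing $S$.
   Context: $C^\circlearrowright_r$ is the directed cycle of length $r$; an orientation is $C^\circlearrowright_r$-free if it contains no copy of it. $\alpha(G)$ is the independence number of $G$. An orientation of $G$ "contains $S$" if each directed edge in $S$ appears with that direction. -}

module Defs where

open import Data.Nat using (ℕ; suc; _≤_)
open import Data.Fin using (Fin; toℕ; fromℕ<)
open import Data.Fin.Properties using ()
open import Data.Bool using (Bool; true; false; _∨_; _∧_)
open import Data.Product using (Σ; _×_; _,_; ∃)
open import Data.List using (List; length)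
open import Data.List.Membership.Propositional using (_∈_)
open import Data.List.Relation.Unary.Unique.Propositional using (Unique)
open import Data.Nat.DivMod using (_%_; m%n<n)
open import Relation.Binary.PropositionalEquality using (_≡_)
open import Relation.Nullary using (¬_)
open import Function.Definitions using (Injective)

record Graph (n : ℕ) : Set where
  field
    adj   : Fin n → Fin n → Bool
    sym   : ∀ u v → adj u v ≡ adj v u
    irrefl : ∀ u → adj u u ≡ false
open Graph public

record IsOrientation {n : ℕ} (G : Graph n) (o : Fin n → Fin n → Bool) : Set where
  field
    cover    : ∀ u v → o u v ∨ o v u ≡ adj G u v
    antisym  : ∀ u v → o u v ∧ o v u ≡ false
open IsOrientation public

next : {r : ℕ} → Fin (suc r) → Fin (suc r)
next {r} i = fromℕ< (m%n<n (suc (toℕ i)) (suc r))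

-- A copy of the directed cycle of length r in the digraph o:
-- distinct vertices c 0, …, c (r-1) with arcs c i → c (i+1 mod r).
-- (Stated for r = suc k; lengths r ≥ 3 are used below.)
DirCycle : {n : ℕ} (k : ℕ) (o : Fin n → Fin n → Bool) → Set
DirCycle {n} k o =
  Σ (Fin (suc k) → Fin n) λ c →
    Injective _≡_ _≡_ c × (∀ i → o (c i) (c (next i)) ≡ true)

CycleFree : {n : ℕ} (k : ℕ) (o : Fin n → Fin n → Bool) → Set
CycleFree k o = ¬ DirCycle k o

IsIndependent : {n : ℕ} → Graph n → List (Fin n) → Set
IsIndependent G I = Unique I × (∀ u v → u ∈ I → v ∈ I → adj G u v ≡ false)

IsIndependenceNumber : {n : ℕ} → Graph n → ℕ → Set
IsIndependenceNumber G a =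
  (Σ (List _) λ I → IsIndependent G I × length I ≡ a) ×
  (∀ I → IsIndependent G I → length I ≤ a)

ContainsArcs : {n : ℕ} → (Fin n → Fin n → Bool) → List (Fin n × Fin n) → Set
ContainsArcs o S = ∀ {u v} → (u , v) ∈ S → o u v ≡ true

-- Number the vertices and treat them one at a time. For a vertex x, Gallai–Milgram covers the earlier
-- out-neighbours of x by at most α vertex-disjoint directed paths of o; S receives the arcs from x to the
-- first r − 2 vertices of each path, and likewise for the earlier in-neighbours. Let o′ be C_r-free, contain
-- S, and agree with o among the earlier vertices. Along a path p₀ → p₁ → ⋯ the arcs x → pᵢ are then forced
-- by induction on i: the first r − 2 lie in S, and if pᵢ → x for a later i then
-- x → pᵢ₋ᵣ₊₂ → ⋯ → pᵢ → x would be a directed r-cycle of o′. Hence o′ = o, and |S| ≤ n · 2(r − 2)α.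
-- Gallai–Milgram is the usual induction: while there are more than α paths two of their start vertices
-- are adjacent, and two paths can be merged while keeping all start vertices among the old ones.
module Submission where

open import Defs renaming (sym to adj-sym)

open import Data.Bool using (Bool; true; false; _∨_; _∧_)
import Data.Bool as Bool
open import Data.Bool.Properties using (¬-not; ∨-idem)
open import Data.Empty using (⊥-elim)
open import Data.Fin using (Fin; toℕ)
import Data.Fin as Fin
import Data.Fin.Induction as Fin
import Data.Fin.Properties as Fin
open import Data.Fin.Properties using (toℕ-injective; toℕ<n; toℕ-fromℕ<)
open import Data.List using (List; []; _∷_; _++_; length; take; map; concatMap; filter; allFin; deduplicate)
open import Data.List.Membership.Propositional using (_∈_; _∉_; find)
open import Data.List.Membership.Propositional.Properties
  using (∈-++⁺ˡ; ∈-++⁺ʳ; ∈-++⁻; ∈-∃++; ∈-deduplicate⁺; ∈-deduplicate⁻; ∈-filter⁻; ∈-filter⁺; ∈-allFin;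
         ∈-map⁺; ∈-map⁻; ∈-concat⁺′; ∈-concat⁻′)
open import Data.List.NonEmpty using (List⁺; _∷_; [_]; toList)
import Data.List.NonEmpty as List⁺
open import Data.List.Properties
  using (length-++; length-map; length-take; length-tabulate; length-deduplicate)
open import Data.List.Relation.Binary.Permutation.Propositional as ↭ using (_↭_; ↭-refl; ↭-sym; ↭-trans; ↭⇒↭ₛ)
open import Data.List.Relation.Binary.Permutation.Propositional.Properties
  using (∈-resp-↭; All-resp-↭; ↭-length; shift; shifts; ++⁺ˡ; map⁺)
import Data.List.Relation.Binary.Permutation.Setoid.Properties as PermutationSetoid
open import Data.List.Relation.Binary.Subset.Propositional using (_⊆_)
open import Data.List.Relation.Unary.All as All using (All; []; _∷_)
open import Data.List.Relation.Unary.All.Properties as All using (¬All⇒Any¬)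
open import Data.List.Relation.Unary.AllPairs using ([]; _∷_)
open import Data.List.Relation.Unary.Any using (here; there)
open import Data.List.Relation.Unary.Linked using (Linked; []; [-]; _∷_)
open import Data.List.Relation.Unary.Unique.Propositional using (Unique)
open import Data.List.Relation.Unary.Unique.Propositional.Properties
  using (Unique[x∷xs]⇒x∉xs; filter⁺; allFin⁺)
open import Data.List.Relation.Unary.Unique.DecPropositional.Properties using (deduplicate-!)
open import Data.Nat using (ℕ; zero; suc; _≤_; _<_; z≤n; s≤s; _≤?_; _+_; _*_; _∸_)
open import Data.Nat.DivMod using (_%_; m<n⇒m%n≡m; n%n≡0)
open import Data.Nat.Induction using (<-rec)
open import Data.Nat.Properties
  using (≤-refl; ≤-trans; ≤-reflexive; ≤-pred; <-irrefl; <-trans; ≤-<-trans; <⇒≱; ≰⇒>; m≤n⇒m<n∨m≡n;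
         suc-injective; +-identityʳ; +-suc; +-cancelˡ-≡; +-mono-≤; +-monoʳ-≤; m<m+n; *-comm; *-monoˡ-≤;
         ∸-cancelˡ-≡; +-∸-assoc; n∸n≡0; m∸n≤m; m∸n+n≡m; m⊓n≤m; module ≤-Reasoning)
open import Data.Nat.Tactic.RingSolver using (solve-∀)
open import Data.Product using (Σ; ∃; ∃₂; _×_; _,_; proj₁; proj₂; swap)
open import Data.Product.Properties using (≡-dec)
open import Data.Sum using (_⊎_; inj₁; inj₂)
open import Function using (flip; _∘_; id)
import Induction.WellFounded as WF
open import Relation.Binary.Definitions using (DecidableEquality; tri<; tri≈; tri>)
open import Relation.Binary.PropositionalEquality
  using (_≡_; _≢_; refl; sym; trans; cong; cong₂; subst; setoid)
open import Relation.Nullary using (¬_; yes; no; contradiction)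
open import Relation.Nullary.Decidable using (_×-dec_)

module _ {A : Set} where

  Unique-++⁻ˡ : ∀ xs {ys : List A} → Unique (xs ++ ys) → Unique xs
  Unique-++⁻ˡ [] _ = []
  Unique-++⁻ˡ (x ∷ xs) (x∉ ∷ u) = All.tabulate (λ z∈ → All.lookup x∉ (∈-++⁺ˡ z∈)) ∷ Unique-++⁻ˡ xs u

  Unique-++⁻ʳ : ∀ xs {ys : List A} → Unique (xs ++ ys) → Unique ys
  Unique-++⁻ʳ [] u = u
  Unique-++⁻ʳ (x ∷ xs) (_ ∷ u) = Unique-++⁻ʳ xs u

  Unique-resp-↭ : {xs ys : List A} → xs ↭ ys → Unique xs → Unique ys
  Unique-resp-↭ xs↭ys = PermutationSetoid.Unique-resp-↭ (setoid A) (↭⇒↭ₛ xs↭ys)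

  ∈-take⁻ : ∀ k {xs : List A} {w} → w ∈ take k xs → w ∈ xs
  ∈-take⁻ (suc k) {_ ∷ _} (here eq) = here eq
  ∈-take⁻ (suc k) {_ ∷ _} (there w∈) = there (∈-take⁻ k w∈)

  length-take≤ : ∀ k (xs : List A) → length (take k xs) ≤ k
  length-take≤ k xs = ≤-trans (≤-reflexive (length-take k xs)) (m⊓n≤m k (length xs))

  length-mono-⊆ : {xs ys : List A} → Unique xs → xs ⊆ ys → length xs ≤ length ys
  length-mono-⊆ {[]} _ _ = z≤n
  length-mono-⊆ {x ∷ xs} (x∉xs ∷ u) xs⊆ys with ∈-∃++ (xs⊆ys (here refl))
  ... | as , bs , refl =
    ≤-trans (s≤s (length-mono-⊆ u xs⊆as++bs)) (≤-reflexive (sym (↭-length (shift x as bs))))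
    where
    xs⊆as++bs : xs ⊆ as ++ bs
    xs⊆as++bs z∈xs with ∈-resp-↭ (shift x as bs) (xs⊆ys (there z∈xs))
    ... | here refl = contradiction refl (All.lookup x∉xs z∈xs)
    ... | there z∈ = z∈

  Linked-map-∈ : {R S : A → A → Set} {xs : List A} →
    (∀ {u v} → u ∈ xs → v ∈ xs → R u v → S u v) → Linked R xs → Linked S xs
  Linked-map-∈ f [] = []
  Linked-map-∈ f [-] = [-]
  Linked-map-∈ f (r ∷ l) =
    f (here refl) (there (here refl)) r ∷ Linked-map-∈ (λ u∈ v∈ → f (there u∈) (there v∈)) l

length-concatMap-≤ : {A B : Set} {k : ℕ} (f : A → List B) → (∀ x → length (f x) ≤ k) →
  ∀ xs → length (concatMap f xs) ≤ length xs * k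
length-concatMap-≤ f bound [] = z≤n
length-concatMap-≤ f bound (x ∷ xs) =
  ≤-trans (≤-reflexive (length-++ (f x))) (+-mono-≤ (bound x) (length-concatMap-≤ f bound xs))

module _ {V : Set} where

  -- DirCycle with ℕ indices: h 0 → h 1 → ⋯ → h k → h 0, the values of h beyond k being irrelevant.
  record IsCycle (k : ℕ) (d : V → V → Bool) (h : ℕ → V) : Set where
    field
      injective : ∀ {i j} → i ≤ k → j ≤ k → h i ≡ h j → i ≡ j
      arc : ∀ {i} → i < k → d (h i) (h (suc i)) ≡ true
      closing : d (h k) (h 0) ≡ true

  IsCycle-reverse : ∀ {k d h} → IsCycle k (flip d) h → IsCycle k d (λ i → h (k ∸ i))
  IsCycle-reverse {k} {d} {h} c = record
    { injective = λ {i} {j} i≤k j≤k eq → ∸-cancelˡ-≡ i≤k j≤k (injective (m∸n≤m k i) (m∸n≤m k j) eq)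
    ; arc = reversed-arc
    ; closing = subst (λ i → d (h i) (h k) ≡ true) (sym (n∸n≡0 k)) closing
    }
    where
    open IsCycle c
    reversed-arc : ∀ {i} → i < k → d (h (k ∸ i)) (h (k ∸ suc i)) ≡ true
    reversed-arc {i} i<k = subst (λ j → d (h j) (h (k ∸ suc i)) ≡ true) k∸i≡
      (arc (≤-trans (≤-reflexive k∸i≡) (m∸n≤m k i)))
      where
      k∸i≡ : suc (k ∸ suc i) ≡ k ∸ i
      k∸i≡ = sym (+-∸-assoc 1 i<k)

toℕ-next : ∀ {k} (i : Fin (suc k)) → toℕ i < k → toℕ (next i) ≡ suc (toℕ i)
toℕ-next {k} i i<k = trans (toℕ-fromℕ< _) (m<n⇒m%n≡m (s≤s i<k))

toℕ-next-last : ∀ {k} (i : Fin (suc k)) → toℕ i ≡ k → toℕ (next i) ≡ 0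
toℕ-next-last {k} i i≡k = trans (toℕ-fromℕ< _) (trans (cong (λ j → suc j % suc k) i≡k) (n%n≡0 (suc k)))

IsCycle⇒DirCycle : ∀ {n k} {d : Fin n → Fin n → Bool} {h : ℕ → Fin n} → IsCycle k d h → DirCycle k d
IsCycle⇒DirCycle {k = k} {d} {h} c = h ∘ toℕ , h∘toℕ-injective , arc-next
  where
  open IsCycle c
  h∘toℕ-injective : ∀ {i j} → h (toℕ i) ≡ h (toℕ j) → i ≡ j
  h∘toℕ-injective {i} {j} eq = toℕ-injective (injective (≤-pred (toℕ<n i)) (≤-pred (toℕ<n j)) eq)
  arc-next : ∀ i → d (h (toℕ i)) (h (toℕ (next i))) ≡ true
  arc-next i with m≤n⇒m<n∨m≡n (≤-pred (toℕ<n i))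
  ... | inj₁ i<k rewrite toℕ-next i i<k = arc i<k
  ... | inj₂ i≡k rewrite toℕ-next-last i i≡k | i≡k = closing

module Forcing {V : Set} (d : V → V → Bool) (m : ℕ) (acyclic : ∀ h → ¬ IsCycle (2 + m) d h)
               (x : V) (p : ℕ → V) (ℓ : ℕ)
               (p-injective : ∀ {i j} → i < ℓ → j < ℓ → p i ≡ p j → i ≡ j)
               (x∉p : ∀ {i} → i < ℓ → p i ≢ x)
               (p-arc : ∀ {i} → suc i < ℓ → d (p i) (p (suc i)) ≡ true)
               (adjacent : ∀ {i} → i < ℓ → d x (p i) ≡ false → d (p i) x ≡ true)
               (prefix : ∀ {i} → i ≤ m → i < ℓ → d x (p i) ≡ true) where

  window : ℕ → ℕ → V
  window s zero = x
  window s (suc j) = p (s + j)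

  window-cycle : ∀ s → s + suc m < ℓ → d x (p s) ≡ true → d (p (s + suc m)) x ≡ true →
    IsCycle (2 + m) d (window s)
  window-cycle s end<ℓ first last = record { injective = injective ; arc = arc ; closing = last }
    where
    in-range : ∀ {j} → j ≤ suc m → s + j < ℓ
    in-range j≤ = ≤-<-trans (+-monoʳ-≤ s j≤) end<ℓ
    injective : ∀ {i j} → i ≤ 2 + m → j ≤ 2 + m → window s i ≡ window s j → i ≡ j
    injective {zero} {zero} _ _ _ = refl
    injective {zero} {suc j} _ (s≤s j≤) eq = contradiction (sym eq) (x∉p (in-range j≤))
    injective {suc i} {zero} (s≤s i≤) _ eq = contradiction eq (x∉p (in-range i≤))
    injective {suc i} {suc j} (s≤s i≤) (s≤s j≤) eq =
      cong suc (+-cancelˡ-≡ s i j (p-injective (in-range i≤) (in-range j≤) eq))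
    arc : ∀ {j} → j < 2 + m → d (window s j) (window s (suc j)) ≡ true
    arc {zero} _ = subst (λ i → d x (p i) ≡ true) (sym (+-identityʳ s)) first
    arc {suc j} (s≤s j<) = subst (λ i → d (p (s + j)) (p i) ≡ true) (sym (+-suc s j))
      (p-arc (subst (_< ℓ) (+-suc s j) (in-range j<)))

  -- If x ↛ p i with i > m, then x → p (i ∸ suc m) → ⋯ → p i → x would be a cycle, the first arc by induction.
  forced : ∀ {i} → i < ℓ → d x (p i) ≡ true
  forced {i} = <-rec (λ i → i < ℓ → d x (p i) ≡ true) step i
    where
    step : ∀ i → (∀ {j} → j < i → j < ℓ → d x (p j) ≡ true) → i < ℓ → d x (p i) ≡ true
    step i IH i<ℓ with i ≤? m
    ... | yes i≤m = prefix i≤m i<ℓ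
    ... | no i≰m with d x (p i) in e
    ...   | true = refl
    ...   | false = ⊥-elim (acyclic (window s) (window-cycle s end<ℓ (IH s<i (<-trans s<i i<ℓ)) last))
      where
      s = i ∸ suc m
      s+m+1≡i : s + suc m ≡ i
      s+m+1≡i = m∸n+n≡m (≰⇒> i≰m)
      end<ℓ : s + suc m < ℓ
      end<ℓ = subst (_< ℓ) (sym s+m+1≡i) i<ℓ
      s<i : s < i
      s<i = subst (s <_) s+m+1≡i (m<m+n s (s≤s z≤n))
      last : d (p (s + suc m)) x ≡ true
      last = subst (λ j → d (p j) x ≡ true) (sym s+m+1≡i) (adjacent i<ℓ e)

module _ {V : Set} where

  -- the i-th entry of ys, or the junk value x past its end
  lookupOr : V → List V → ℕ → V
  lookupOr x [] _ = x
  lookupOr x (y ∷ ys) zero = y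
  lookupOr x (y ∷ ys) (suc i) = lookupOr x ys i

  lookupOr-∈ : ∀ x {ys i} → i < length ys → lookupOr x ys i ∈ ys
  lookupOr-∈ x {y ∷ ys} {zero} _ = here refl
  lookupOr-∈ x {y ∷ ys} {suc i} (s≤s i<) = there (lookupOr-∈ x i<)

  lookupOr-∈-take : ∀ x {ys i k} → i < k → i < length ys → lookupOr x ys i ∈ take k ys
  lookupOr-∈-take x {y ∷ ys} {zero} {suc k} _ _ = here refl
  lookupOr-∈-take x {y ∷ ys} {suc i} {suc k} (s≤s i<k) (s≤s i<) = there (lookupOr-∈-take x i<k i<)

  ∈⇒lookupOr : ∀ x {ys w} → w ∈ ys → ∃ λ i → i < length ys × lookupOr x ys i ≡ w
  ∈⇒lookupOr x (here refl) = zero , s≤s z≤n , refl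
  ∈⇒lookupOr x (there w∈) with ∈⇒lookupOr x w∈
  ... | i , i< , eq = suc i , s≤s i< , eq

  lookupOr-injective : ∀ x {ys} → Unique ys → ∀ {i j} → i < length ys → j < length ys →
    lookupOr x ys i ≡ lookupOr x ys j → i ≡ j
  lookupOr-injective x {y ∷ ys} _ {zero} {zero} _ _ _ = refl
  lookupOr-injective x {y ∷ ys} (y∉ ∷ _) {zero} {suc j} _ (s≤s j<) eq =
    contradiction eq (All.lookup y∉ (lookupOr-∈ x j<))
  lookupOr-injective x {y ∷ ys} (y∉ ∷ _) {suc i} {zero} (s≤s i<) _ eq =
    contradiction (sym eq) (All.lookup y∉ (lookupOr-∈ x i<))
  lookupOr-injective x {y ∷ ys} (_ ∷ u) {suc i} {suc j} (s≤s i<) (s≤s j<) eq =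
    cong suc (lookupOr-injective x u i< j< eq)

  Linked⇒lookupOr : ∀ x {R : V → V → Set} {ys} → Linked R ys → ∀ {i} → suc i < length ys →
    R (lookupOr x ys i) (lookupOr x ys (suc i))
  Linked⇒lookupOr x [-] {_} (s≤s ())
  Linked⇒lookupOr x (r ∷ _) {zero} _ = r
  Linked⇒lookupOr x (_ ∷ l) {suc i} (s≤s i<) = Linked⇒lookupOr x l i<

module _ {V : Set} (d : V → V → Bool) (m : ℕ) (acyclic : ∀ h → ¬ IsCycle (2 + m) d h) (x : V) where

  forced-along-path : ∀ {ys} → Linked (λ u v → d u v ≡ true) ys → Unique ys → x ∉ ys →
    (∀ {z} → z ∈ ys → d x z ≡ false → d z x ≡ true) →
    (∀ {z} → z ∈ take (suc m) ys → d x z ≡ true) →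
    ∀ {z} → z ∈ ys → d x z ≡ true
  forced-along-path {ys} path unique x∉ys adjacent prefix z∈ys with ∈⇒lookupOr x z∈ys
  ... | i , i< , refl = Forcing.forced d m acyclic x (lookupOr x ys) (length ys)
    (lookupOr-injective x unique)
    (λ i< eq → x∉ys (subst (_∈ ys) eq (lookupOr-∈ x i<)))
    (Linked⇒lookupOr x path)
    (λ i< → adjacent (lookupOr-∈ x i<))
    (λ i≤m i< → prefix (lookupOr-∈-take x (s≤s i≤m) i<))
    i<

module _ {V : Set} where

  vertices : List (List⁺ V) → List V
  vertices = concatMap toList

  heads : List (List⁺ V) → List V
  heads = map List⁺.head

  vertices-↭ : {Ps Qs : List (List⁺ V)} → Ps ↭ Qs → vertices Ps ↭ vertices Qs
  vertices-↭ ↭.refl = ↭-refl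
  vertices-↭ (↭.prep p Ps↭Qs) = ++⁺ˡ (toList p) (vertices-↭ Ps↭Qs)
  vertices-↭ (↭.swap p q Ps↭Qs) =
    ↭-trans (shifts (toList p) (toList q)) (++⁺ˡ (toList q) (++⁺ˡ (toList p) (vertices-↭ Ps↭Qs)))
  vertices-↭ (↭.trans Ps↭Qs Qs↭Rs) = ↭-trans (vertices-↭ Ps↭Qs) (vertices-↭ Qs↭Rs)

  ∈-vertices⁺ : ∀ {Ps p w} → p ∈ Ps → w ∈ toList p → w ∈ vertices Ps
  ∈-vertices⁺ p∈ w∈ = ∈-concat⁺′ w∈ (∈-map⁺ toList p∈)

  ∈-vertices⁻ : ∀ Ps {w} → w ∈ vertices Ps → ∃ λ p → p ∈ Ps × w ∈ toList p
  ∈-vertices⁻ Ps w∈ with ∈-concat⁻′ (map toList Ps) w∈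
  ... | _ , w∈ys , ys∈ with ∈-map⁻ toList ys∈
  ...   | p , p∈ , refl = p , p∈ , w∈ys

  heads⊆vertices : ∀ {Ps} → heads Ps ⊆ vertices Ps
  heads⊆vertices {p ∷ _} (here refl) = here refl
  heads⊆vertices {(_ ∷ t) ∷ _} (there h∈) = there (∈-++⁺ʳ t (heads⊆vertices h∈))

  Unique-heads : ∀ Ps → Unique (vertices Ps) → Unique (heads Ps)
  Unique-heads [] _ = []
  Unique-heads ((h ∷ t) ∷ Ps) (h∉ ∷ u) =
    All.tabulate (λ z∈ → All.lookup h∉ (∈-++⁺ʳ t (heads⊆vertices z∈))) ∷ Unique-heads Ps (Unique-++⁻ʳ t u)

  Unique-path : ∀ {Ps p} → Unique (vertices Ps) → p ∈ Ps → Unique (toList p)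
  Unique-path {p ∷ _} u (here refl) = Unique-++⁻ˡ (toList p) u
  Unique-path {q ∷ _} u (there p∈) = Unique-path (Unique-++⁻ʳ (toList q) u) p∈

  ∈-heads⇒↭ : ∀ {Ps x} → x ∈ heads Ps → ∃₂ λ t R → Ps ↭ (x ∷ t) ∷ R
  ∈-heads⇒↭ x∈ with ∈-map⁻ List⁺.head x∈
  ... | x ∷ t , p∈ , refl with ∈-∃++ p∈
  ...   | as , bs , refl = t , as ++ bs , shift (x ∷ t) as bs

  vertices-singletons : ∀ W → vertices (map [_] W) ≡ W
  vertices-singletons [] = refl
  vertices-singletons (w ∷ W) = cong (w ∷_) (vertices-singletons W)

module GallaiMilgram {V : Set} (_≟_ : DecidableEquality V) (d : V → V → Bool)
    (loopless : ∀ v → d v v ≡ false) (a : ℕ)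
    (independent-bound : ∀ I → Unique I → (∀ {u v} → u ∈ I → v ∈ I → d u v ≡ false) → length I ≤ a) where

  open import Data.List.Membership.DecPropositional _≟_ using (_∈?_)

  IsPath : List⁺ V → Set
  IsPath p = Linked (λ u v → d u v ≡ true) (toList p)

  independent-or-arc : ∀ I →
    (∀ {u v} → u ∈ I → v ∈ I → d u v ≡ false) ⊎ (∃₂ λ u v → u ∈ I × v ∈ I × d u v ≡ true)
  independent-or-arc I with All.all? (λ u → All.all? (λ v → d u v Bool.≟ false) I) I
  ... | yes no-arcs = inj₁ λ u∈ v∈ → All.lookup (All.lookup no-arcs u∈) v∈
  ... | no some-arc with find (¬All⇒Any¬ (λ u → All.all? (λ v → d u v Bool.≟ false) I) I some-arc)
  ...   | u , u∈ , some-arc-from-u with find (¬All⇒Any¬ (λ v → d u v Bool.≟ false) I some-arc-from-u)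
  ...     | v , v∈ , duv≢false = inj₂ (u , v , u∈ , v∈ , ¬-not duv≢false)

  record FewerPaths (Ps : List (List⁺ V)) : Set where
    field
      paths : List (List⁺ V)
      are-paths : All IsPath paths
      same-vertices : vertices paths ↭ vertices Ps
      one-fewer : suc (length paths) ≡ length Ps
      heads⊆ : heads paths ⊆ heads Ps

  open FewerPaths

  FewerPaths-resp-↭ : ∀ {Ps Qs} → Ps ↭ Qs → FewerPaths Qs → FewerPaths Ps
  FewerPaths-resp-↭ Ps↭Qs F = record
    { paths = paths F
    ; are-paths = are-paths F
    ; same-vertices = ↭-trans (same-vertices F) (vertices-↭ (↭-sym Ps↭Qs))
    ; one-fewer = trans (one-fewer F) (sym (↭-length Ps↭Qs))
    ; heads⊆ = ∈-resp-↭ (map⁺ List⁺.head (↭-sym Ps↭Qs)) ∘ heads⊆ F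
    }

  merge : ∀ {x y t₂ R} → d x y ≡ true → All IsPath ((x ∷ []) ∷ (y ∷ t₂) ∷ R) →
    FewerPaths ((x ∷ []) ∷ (y ∷ t₂) ∷ R)
  merge {x} {y} {t₂} {R} dxy (_ ∷ path-y ∷ paths-R) = record
    { paths = (x ∷ y ∷ t₂) ∷ R
    ; are-paths = (dxy ∷ path-y) ∷ paths-R
    ; same-vertices = ↭-refl
    ; one-fewer = refl
    ; heads⊆ = λ { (here eq) → here eq ; (there z∈) → there (there z∈) }
    }

  prepend : ∀ {x x′ t′ Y} (F : FewerPaths ((x′ ∷ t′) ∷ Y)) {h s R} → paths F ↭ (h ∷ s) ∷ R →
    d x h ≡ true → x′ ∉ heads R → FewerPaths ((x ∷ x′ ∷ t′) ∷ Y)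
  prepend {x} F {h} {s} {R} F↭ dxh x′∉R with All-resp-↭ F↭ (are-paths F)
  ... | path-h ∷ paths-R = record
    { paths = (x ∷ h ∷ s) ∷ R
    ; are-paths = (dxh ∷ path-h) ∷ paths-R
    ; same-vertices = ↭.prep x (↭-trans (vertices-↭ (↭-sym F↭)) (same-vertices F))
    ; one-fewer = trans (cong suc (sym (↭-length F↭))) (one-fewer F)
    ; heads⊆ = λ { (here eq) → here eq ; (there z∈R) → old-head z∈R }
    }
    where
    old-head : ∀ {z} → z ∈ heads R → z ∈ x ∷ _
    old-head z∈R with heads⊆ F (∈-resp-↭ (map⁺ List⁺.head (↭-sym F↭)) (there z∈R))
    ... | here refl = contradiction z∈R x′∉R
    ... | there z∈ = there z∈

  Unique-heads-paths : ∀ {Ps} → Unique (vertices Ps) → (F : FewerPaths Ps) → Unique (heads (paths F))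
  Unique-heads-paths unique F = Unique-heads (paths F) (Unique-resp-↭ (↭-sym (same-vertices F)) unique)

  -- If neither x′ nor y started a path any more, the n − 1 new paths would start in the n − 2 old heads of R.
  reattach : ∀ {x x′ t′ y t₂ R} → d x x′ ≡ true → d x y ≡ true →
    Unique (vertices ((x′ ∷ t′) ∷ (y ∷ t₂) ∷ R)) → FewerPaths ((x′ ∷ t′) ∷ (y ∷ t₂) ∷ R) →
    FewerPaths ((x ∷ x′ ∷ t′) ∷ (y ∷ t₂) ∷ R)
  reattach {x′ = x′} {y = y} {R = R} dxx′ dxy unique F with x′ ∈? heads (paths F) | y ∈? heads (paths F)
  ... | yes x′∈ | _ = let _ , _ , F↭ = ∈-heads⇒↭ x′∈ in
    prepend F F↭ dxx′ (Unique[x∷xs]⇒x∉xs (Unique-resp-↭ (map⁺ List⁺.head F↭) (Unique-heads-paths unique F)))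
  ... | no x′∉ | yes y∈ = let _ , _ , F↭ = ∈-heads⇒↭ y∈ in
    prepend F F↭ dxy (x′∉ ∘ ∈-resp-↭ (map⁺ List⁺.head (↭-sym F↭)) ∘ there)
  ... | no x′∉ | no y∉ = contradiction (length-mono-⊆ (Unique-heads-paths unique F) new⊆old) (<⇒≱ more-heads)
    where
    new⊆old : heads (paths F) ⊆ heads R
    new⊆old z∈ with heads⊆ F z∈
    ... | here refl = contradiction z∈ x′∉
    ... | there (here refl) = contradiction z∈ y∉
    ... | there (there z∈R) = z∈R
    more-heads : length (heads R) < length (heads (paths F))
    more-heads rewrite length-map List⁺.head R | length-map List⁺.head (paths F) =
      ≤-reflexive (sym (suc-injective (one-fewer F)))

  mutual
    shrink : ∀ N Ps → length (vertices Ps) ≤ N → All IsPath Ps → Unique (vertices Ps) → a < length Ps →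
      FewerPaths Ps
    shrink N Ps size are-paths unique a<len with independent-or-arc (heads Ps)
    ... | inj₁ independent =
      contradiction (independent-bound (heads Ps) (Unique-heads Ps unique) independent)
        (<⇒≱ (subst (a <_) (sym (length-map List⁺.head Ps)) a<len))
    ... | inj₂ (x , y , x∈ , y∈ , dxy) with ∈-heads⇒↭ x∈
    ...   | _ , R₁ , Ps↭x∷R₁ with ∈-resp-↭ (map⁺ List⁺.head Ps↭x∷R₁) y∈
    ...     | here refl = contradiction (trans (sym dxy) (loopless x)) λ ()
    ...     | there y∈R₁ with ∈-heads⇒↭ y∈R₁
    ...       | _ , _ , R₁↭y∷R = FewerPaths-resp-↭ Ps↭Q
      (shrink-along-arc N (subst (_≤ N) (↭-length (vertices-↭ Ps↭Q)) size) (All-resp-↭ Ps↭Q are-paths)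
        (Unique-resp-↭ (vertices-↭ Ps↭Q) unique) (subst (a <_) (↭-length Ps↭Q) a<len) dxy)
      where
      Ps↭Q = ↭-trans Ps↭x∷R₁ (↭.prep _ R₁↭y∷R)

    shrink-along-arc : ∀ N {x t y t₂ R} → length (vertices ((x ∷ t) ∷ (y ∷ t₂) ∷ R)) ≤ N →
      All IsPath ((x ∷ t) ∷ (y ∷ t₂) ∷ R) → Unique (vertices ((x ∷ t) ∷ (y ∷ t₂) ∷ R)) →
      a < length ((x ∷ t) ∷ (y ∷ t₂) ∷ R) → d x y ≡ true → FewerPaths ((x ∷ t) ∷ (y ∷ t₂) ∷ R)
    shrink-along-arc N {t = []} _ are-paths _ _ dxy = merge dxy are-paths
    shrink-along-arc (suc N) {t = x′ ∷ t′} (s≤s size) ((dxx′ ∷ path-x′) ∷ are-paths) (_ ∷ unique) a<len dxy =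
      reattach dxx′ dxy unique (shrink N _ size (path-x′ ∷ are-paths) unique a<len)

  record PathCover (W : List V) : Set where
    field
      paths : List (List⁺ V)
      are-paths : All IsPath paths
      covers : vertices paths ↭ W
      at-most-a : length paths ≤ a

  PathCover-resp-↭ : ∀ {W W′} → W ↭ W′ → PathCover W → PathCover W′
  PathCover-resp-↭ W↭W′ C = record
    { paths = PathCover.paths C
    ; are-paths = PathCover.are-paths C
    ; covers = ↭-trans (PathCover.covers C) W↭W′
    ; at-most-a = PathCover.at-most-a C
    }

  shrink-repeatedly : ∀ fuel Ps → length Ps ≤ fuel → All IsPath Ps → Unique (vertices Ps) →
    PathCover (vertices Ps)
  shrink-repeatedly fuel Ps len Ps-paths unique with length Ps ≤? a
  ... | yes ≤a = record { paths = Ps ; are-paths = Ps-paths ; covers = ↭-refl ; at-most-a = ≤a }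
  shrink-repeatedly zero Ps len _ _ | no ≰a = contradiction (≤-trans len z≤n) ≰a
  shrink-repeatedly (suc fuel) Ps len Ps-paths unique | no ≰a =
    PathCover-resp-↭ (same-vertices F)
      (shrink-repeatedly fuel (paths F) (≤-pred (subst (_≤ suc fuel) (sym (one-fewer F)) len)) (are-paths F)
        (Unique-resp-↭ (↭-sym (same-vertices F)) unique))
    where
    F = shrink _ Ps ≤-refl Ps-paths unique (≰⇒> ≰a)

  gallai-milgram : ∀ W → Unique W → PathCover W
  gallai-milgram W unique = subst PathCover (vertices-singletons W)
    (shrink-repeatedly _ (map [_] W) ≤-refl (All.map⁺ (All.universal (λ _ → [-]) W))
      (subst Unique (sym (vertices-singletons W)) unique))

∨≡false⇒ˡ : ∀ b {c} → b ∨ c ≡ false → b ≡ false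
∨≡false⇒ˡ false _ = refl

module _ {n : ℕ} {G : Graph n} where

  IsOrientation-flip : ∀ {o} → IsOrientation G o → IsOrientation G (flip o)
  IsOrientation-flip O = record
    { cover = λ u v → trans (cover O v u) (adj-sym G v u)
    ; antisym = λ u v → antisym O v u
    }

  orientation-loopless : ∀ {o} → IsOrientation G o → ∀ v → o v v ≡ false
  orientation-loopless {o} O v = trans (sym (∨-idem (o v v))) (trans (cover O v v) (irrefl G v))

  arc⇒¬reverse : ∀ {o} → IsOrientation G o → ∀ {u v} → o u v ≡ true → o v u ≡ false
  arc⇒¬reverse {o} O {u} {v} ouv = trans (cong (_∧ o v u) (sym ouv)) (antisym O u v)

  edge⇒reverse : ∀ {o} → IsOrientation G o → ∀ {u v} → adj G u v ≡ true → o u v ≡ false → o v u ≡ true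
  edge⇒reverse {o} O {u} {v} edge ouv = trans (cong (_∨ o v u) (sym ouv)) (trans (cover O u v) edge)

  no-arcs⇒independent : ∀ {o} → IsOrientation G o → ∀ {I} → (∀ {u v} → u ∈ I → v ∈ I → o u v ≡ false) →
    ∀ u v → u ∈ I → v ∈ I → adj G u v ≡ false
  no-arcs⇒independent O no-arcs u v u∈ v∈ =
    trans (sym (cover O u v)) (cong₂ _∨_ (no-arcs u∈ v∈) (no-arcs v∈ u∈))

  ⊇⇒≡ : ∀ {o o′} → IsOrientation G o → IsOrientation G o′ → (∀ {u v} → o u v ≡ true → o′ u v ≡ true) →
    ∀ u v → o′ u v ≡ o u v
  ⊇⇒≡ {o} {o′} O O′ o⊆o′ u v with o u v in ouv | o v u in ovu
  ... | true | _ = o⊆o′ ouv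
  ... | false | true = arc⇒¬reverse O′ (o⊆o′ ovu)
  ... | false | false = ∨≡false⇒ˡ (o′ u v)
    (trans (cover O′ u v) (trans (sym (cover O u v)) (cong₂ _∨_ ouv ovu)))

count-twice : ∀ n k a → n * (k * a + k * a) ≡ 2 * n * k * a
count-twice = solve-∀

module Construction {n : ℕ} (G : Graph n) (m a : ℕ) (α-bound : ∀ I → IsIndependent G I → length I ≤ a) where

  earlier-out-neighbours : (Fin n → Fin n → Bool) → Fin n → List (Fin n)
  earlier-out-neighbours d x = filter (λ w → w Fin.<? x ×-dec d x w Bool.≟ true) (allFin n)

  module ForcingArcs {d : Fin n → Fin n → Bool} (D : IsOrientation G d) where
    open GallaiMilgram Fin._≟_ d (orientation-loopless D) a
      (λ I unique no-arcs → α-bound I (unique , no-arcs⇒independent D no-arcs))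
    open PathCover

    opaque
      out-cover : ∀ x → PathCover (earlier-out-neighbours d x)
      out-cover x = gallai-milgram _ (filter⁺ _ (allFin⁺ n))

    prefix : List⁺ (Fin n) → List (Fin n)
    prefix = take (suc m) ∘ toList

    forcing-arcs : Fin n → List (Fin n × Fin n)
    forcing-arcs x = map (x ,_) (concatMap prefix (paths (out-cover x)))

    length-forcing-arcs : ∀ x → length (forcing-arcs x) ≤ suc m * a
    length-forcing-arcs x = begin
      length (forcing-arcs x)              ≡⟨ length-map (x ,_) (concatMap prefix (paths C)) ⟩
      length (concatMap prefix (paths C))  ≤⟨ length-concatMap-≤ prefix (length-take≤ (suc m) ∘ toList) (paths C) ⟩
      length (paths C) * suc m             ≤⟨ *-monoˡ-≤ (suc m) (at-most-a C) ⟩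
      a * suc m                            ≡⟨ *-comm a (suc m) ⟩
      suc m * a                            ∎
      where
      open ≤-Reasoning
      C = out-cover x

    on-cover : ∀ x {p w} → p ∈ paths (out-cover x) → w ∈ toList p → w Fin.< x × d x w ≡ true
    on-cover x p∈ w∈p = proj₂ (∈-filter⁻ _ {xs = allFin n}
      (∈-resp-↭ (covers (out-cover x)) (∈-vertices⁺ p∈ w∈p)))

    forcing-arcs-⊆ : ∀ x {u v} → (u , v) ∈ forcing-arcs x → d u v ≡ true
    forcing-arcs-⊆ x uv∈ with ∈-map⁻ (x ,_) uv∈
    ... | w , w∈ , refl with ∈-concat⁻′ (map prefix (paths (out-cover x))) w∈
    ...   | _ , w∈prefix , prefix∈ with ∈-map⁻ prefix prefix∈
    ...     | p , p∈ , refl = proj₂ (on-cover x p∈ (∈-take⁻ (suc m) w∈prefix))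

    module _ {d′ : Fin n → Fin n → Bool} (D′ : IsOrientation G d′) (acyclic : ∀ h → ¬ IsCycle (2 + m) d′ h)
             (x : Fin n) (earlier-arcs-kept : ∀ {u v} → u Fin.< x → v Fin.< x → d u v ≡ true → d′ u v ≡ true)
             (forcing-arcs-kept : ∀ {u v} → (u , v) ∈ forcing-arcs x → d′ u v ≡ true) where

      forced-on-path : ∀ {p w} → p ∈ paths (out-cover x) → w ∈ toList p → d′ x w ≡ true
      forced-on-path {p} p∈ = forced-along-path d′ m acyclic x
        (Linked-map-∈ (λ u∈ v∈ → earlier-arcs-kept (proj₁ (on-cover x p∈ u∈)) (proj₁ (on-cover x p∈ v∈)))
          (All.lookup (are-paths C) p∈))
        (Unique-path (Unique-resp-↭ (↭-sym (covers C)) (filter⁺ _ (allFin⁺ n))) p∈)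
        (λ x∈p → <-irrefl refl (proj₁ (on-cover x p∈ x∈p)))
        (λ z∈p → edge⇒reverse D′ (trans (sym (cover D x _)) (cong (_∨ d _ x) (proj₂ (on-cover x p∈ z∈p)))))
        (λ z∈ → forcing-arcs-kept (∈-map⁺ (x ,_) (∈-concat⁺′ z∈ (∈-map⁺ prefix p∈))))
        where
        C = out-cover x

      forced : ∀ {w} → w Fin.< x → d x w ≡ true → d′ x w ≡ true
      forced {w} w<x dxw =
        let w∈cover = ∈-resp-↭ (↭-sym (covers C)) (∈-filter⁺ _ (∈-allFin w) (w<x , dxw))
            p , p∈ , w∈p = ∈-vertices⁻ (paths C) w∈cover
        in forced-on-path p∈ w∈p
        where
        C = out-cover x

  module Certificate {o : Fin n → Fin n → Bool} (O : IsOrientation G o) where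
    module Out = ForcingArcs O
    module In = ForcingArcs (IsOrientation-flip O)

    -- in-arcs of x are the out-arcs of x in the reversed orientation
    forcing-arcs-at : Fin n → List (Fin n × Fin n)
    forcing-arcs-at x = Out.forcing-arcs x ++ map swap (In.forcing-arcs x)

    _≟ᵉ_ : DecidableEquality (Fin n × Fin n)
    _≟ᵉ_ = ≡-dec Fin._≟_ Fin._≟_

    S : List (Fin n × Fin n)
    S = deduplicate _≟ᵉ_ (concatMap forcing-arcs-at (allFin n))

    S-unique : Unique S
    S-unique = deduplicate-! _≟ᵉ_ _

    ∈-S⁺ : ∀ x {e} → e ∈ forcing-arcs-at x → e ∈ S
    ∈-S⁺ x e∈ = ∈-deduplicate⁺ _≟ᵉ_ (∈-concat⁺′ e∈ (∈-map⁺ forcing-arcs-at (∈-allFin x)))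

    S-⊆-o : ContainsArcs o S
    S-⊆-o e∈S with ∈-concat⁻′ (map forcing-arcs-at (allFin n)) (∈-deduplicate⁻ _ _ e∈S)
    ... | _ , e∈ , arcs∈ with ∈-map⁻ forcing-arcs-at arcs∈
    ...   | x , _ , refl with ∈-++⁻ (Out.forcing-arcs x) e∈
    ...     | inj₁ e∈out = Out.forcing-arcs-⊆ x e∈out
    ...     | inj₂ e∈in with ∈-map⁻ swap e∈in
    ...       | _ , e∈in′ , refl = In.forcing-arcs-⊆ x e∈in′

    length-S : length S ≤ 2 * n * suc m * a
    length-S = begin
      length S                 ≤⟨ length-deduplicate _≟ᵉ_ all-arcs ⟩
      length all-arcs          ≤⟨ length-concatMap-≤ forcing-arcs-at length-at (allFin n) ⟩
      length (allFin n) * k    ≡⟨ cong (_* k) (length-tabulate {n = n} id) ⟩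
      n * k                    ≡⟨ count-twice n (suc m) a ⟩
      2 * n * suc m * a        ∎
      where
      open ≤-Reasoning
      all-arcs = concatMap forcing-arcs-at (allFin n)
      k = suc m * a + suc m * a
      length-at : ∀ x → length (forcing-arcs-at x) ≤ k
      length-at x = ≤-trans (≤-reflexive (length-++ (Out.forcing-arcs x)))
        (+-mono-≤ (Out.length-forcing-arcs x)
          (≤-trans (≤-reflexive (length-map swap (In.forcing-arcs x))) (In.length-forcing-arcs x)))

    module _ (o′ : Fin n → Fin n → Bool) (O′ : IsOrientation G o′) (cf′ : CycleFree (2 + m) o′)
             (S-kept : ContainsArcs o′ S) where

      ArcsKeptBelow : Fin n → Set
      ArcsKeptBelow x = ∀ {w} → w Fin.< x → (o x w ≡ true → o′ x w ≡ true) × (o w x ≡ true → o′ w x ≡ true)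

      arc-kept : ∀ {u v} → ArcsKeptBelow u → ArcsKeptBelow v → o u v ≡ true → o′ u v ≡ true
      arc-kept {u} {v} kept-u kept-v ouv with Fin.<-cmp u v
      ... | tri< u<v _ _ = proj₂ (kept-v u<v) ouv
      ... | tri≈ _ refl _ = contradiction (trans (sym ouv) (orientation-loopless O u)) λ ()
      ... | tri> _ _ v<u = proj₁ (kept-u v<u) ouv

      arcs-kept-below : ∀ x → ArcsKeptBelow x
      arcs-kept-below = WF.All.wfRec Fin.<-wellFounded _ ArcsKeptBelow step
        where
        step : ∀ x → (∀ {y} → y Fin.< x → ArcsKeptBelow y) → ArcsKeptBelow x
        step x IH w<x =
          Out.forced O′ (λ h → cf′ ∘ IsCycle⇒DirCycle) x earlier-kept
            (λ uv∈ → S-kept (∈-S⁺ x (∈-++⁺ˡ uv∈))) w<x ,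
          In.forced (IsOrientation-flip O′) (λ h → cf′ ∘ IsCycle⇒DirCycle ∘ IsCycle-reverse) x
            (λ u<x v<x → earlier-kept v<x u<x)
            (λ uv∈ → S-kept (∈-S⁺ x (∈-++⁺ʳ (Out.forcing-arcs x) (∈-map⁺ swap uv∈)))) w<x
          where
          earlier-kept : ∀ {u v} → u Fin.< x → v Fin.< x → o u v ≡ true → o′ u v ≡ true
          earlier-kept u<x v<x = arc-kept (IH u<x) (IH v<x)

      o′≡o : ∀ u v → o′ u v ≡ o u v
      o′≡o = ⊇⇒≡ O O′ (arc-kept (arcs-kept-below _) (arcs-kept-below _))

lemma6p4 : (n r : ℕ) → 3 ≤ r → (G : Graph n) → (a : ℕ) → IsIndependenceNumber G a →
    (o : Fin n → Fin n → Bool) → IsOrientation G o → CycleFree (r ∸ 1) o →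
    Σ (List (Fin n × Fin n)) λ S →
      Unique S × ContainsArcs o S × length S ≤ 2 * n * (r ∸ 2) * a ×
      ((o' : Fin n → Fin n → Bool) → IsOrientation G o' → CycleFree (r ∸ 1) o' →
        ContainsArcs o' S → ∀ u v → o' u v ≡ o u v)
lemma6p4 n (suc (suc (suc m))) (s≤s (s≤s (s≤s z≤n))) G a (_ , α-bound) o O _ =
  S , S-unique , S-⊆-o , length-S , o′≡o
  where
  open Construction G m a α-bound
  open Certificate O
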